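{- Let $\mathcal{S}=\langle\mathcal{L},\vdash\rangle$ be a monotonic logic. If $\mathcal{S}$ is NF-paraconsistent, then there does not exist any $\varphi\in\mathcal{L}$ such that $C_\vdash(\{\varphi\})=\mathcal{L}$.
   Context: A logic is a pair $\mathcal{S}=\langle\mathcal{L},\vdash\rangle$ where $\mathcal{L}$ is an arbitrary set and $\vdash\,\subseteq\mathcal{P}(\mathcal{L})\times\mathcal{L}$. For $\Gamma\subseteq\mathcal{L}$, $C_\vdash(\Gamma)=\{\alpha\in\mathcal{L}:\Gamma\vdash\alpha\}$. $\mathcal{S}$ is monotonic if $\Gamma\subseteq\Sigma\subseteq\mathcal{L}$ implies $C_\vdash(\Gamma)\subseteq C_\vdash(\Sigma)$. The principle gECQ says: for each $\alpha\in\mathcal{L}$ there exists $\beta\in\mathcal{L}$ with $C_\vdash(\{\alpha,\beta\})=\mathcal{L}$. $\mathcal{S}$ is NF-paraconsistent if gECQ fails, i.e., there exists $\alpha\in\mathcal{L}$ such that $C_\vdash(\{\alpha,\beta\})\neq\mathcal{L}$ for every $\beta\in\mathcal{L}$. -}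

module Defs where

open import Level using (Level; suc; _⊔_)
open import Data.Sum using (_⊎_)
open import Data.Product using (∃)
open import Relation.Binary.PropositionalEquality using (_≡_)
open import Relation.Nullary using (¬_)
open import Relation.Unary using (Pred; _⊆_; Universal)

record Logic (a ℓ r : Level) : Set (Level.suc (a ⊔ ℓ ⊔ r)) where
  field
    L   : Set a
    _⊢_ : Pred L ℓ → L → Set r

module _ {a ℓ r : Level} (S : Logic a ℓ r) where
  open Logic S

  C : Pred L ℓ → Pred L r
  C Γ α = Γ ⊢ α

  Trivializes : Pred L ℓ → Set (a ⊔ r)
  Trivializes Γ = Universal (C Γ)

  Monotonic : Set (a ⊔ Level.suc ℓ ⊔ r)
  Monotonic = ∀ (Γ Σ : Pred L ℓ) → Γ ⊆ Σ → C Γ ⊆ C Σ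

-- singleton and pair subsets (at level a, so ℓ = a below)
｛_｝ : ∀ {a} {A : Set a} → A → Pred A a
｛ x ｝ = λ y → y ≡ x

｛_,_｝ : ∀ {a} {A : Set a} → A → A → Pred A a
｛ x , z ｝ = λ y → (y ≡ x) ⊎ (y ≡ z)

module _ {a r : Level} (S : Logic a a r) where
  open Logic S

  gECQ : Set (a ⊔ r)
  gECQ = ∀ (α : L) → ∃ λ (β : L) → Trivializes S ｛ α , β ｝

  NF-paraconsistent : Set (a ⊔ r)
  NF-paraconsistent = ∃ λ (α : L) → ∀ (β : L) → ¬ Trivializes S ｛ α , β ｝

{-# OPTIONS --safe #-}
module Submission where

open import Defs
open import Level using (Level)
open import Data.Product using (∃; _,_)
open import Data.Sum using (inj₂)
open import Relation.Nullary using (¬_)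
open import Relation.Unary using (Pred; _⊆_)

Trivializes-⊆ : ∀ {a ℓ r} (S : Logic a ℓ r) → Monotonic S →
                {Γ Σ : Pred (Logic.L S) ℓ} → Γ ⊆ Σ → Trivializes S Γ → Trivializes S Σ
Trivializes-⊆ S mono {Γ} {Σ} Γ⊆Σ trivΓ β = mono Γ Σ Γ⊆Σ (trivΓ β)

theorem2p3 : ∀ {a r : Level} (S : Logic a a r) → Monotonic S → NF-paraconsistent S → ¬ (∃ λ (φ : Logic.L S) → Trivializes S ｛ φ ｝)
theorem2p3 S mono (α , ¬trivα) (φ , trivφ) =
  ¬trivα φ (Trivializes-⊆ S mono inj₂ trivφ)
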